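{- Let $r\geq t\geq 3$ and $n_1\geq\cdots\geq n_r\geq 1$. Then $f(n_1,\ldots,n_r,1,t)\geq f(n_1,\ldots,n_r,1,t-1)+n_{t-1}^2$.
   Context: For $I\subseteq[r]$, $n_I=\sum_{i\in I}n_i$. For $s\geq 2$, $f(n_1,\ldots,n_r,1,s)=\max_{\mathcal{Q}}\sum n_In_{I'}$, where the maximum is over all partitions $\mathcal{Q}$ of $[r]$ into $s-1$ parts and the sum over unordered pairs $\{I,I'\}$ of distinct parts of $\mathcal{Q}$. -}

module Defs where

open import Data.Bool using (Bool; true; false; if_then_else_)
open import Data.Nat using (ℕ; zero; suc; _+_; _*_; _∸_; _⊔_; _<ᵇ_)
open import Data.Fin using (Fin; toℕ)
open import Data.Fin.Properties using (_≟_)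
open import Data.List using (List; []; _∷_; [_]; map; concatMap; filterᵇ; foldr; allFin)
open import Data.Nat.ListAction using (sum)
open import Data.Bool.ListAction using (all; any)
open import Data.Vec using (Vec; []; _∷_; lookup; toList)
open import Relation.Nullary.Decidable using (⌊_⌋)

allMaps : (k r : ℕ) → List (Vec (Fin k) r)
allMaps k zero = [ [] ]
allMaps k (suc r) = concatMap (λ x → map (x ∷_) (allMaps k r)) (allFin k)

-- A map c : [r] → [k] is surjective; the fibres of a surjective map form a
-- partition of [r] into exactly k (nonempty) parts, and every such partition
-- arises this way (up to labelling of the parts, which does not affect the sum).
isSurj : {k r : ℕ} → Vec (Fin k) r → Bool
isSurj {k} c = all (λ j → any (λ x → ⌊ x ≟ j ⌋) (toList c)) (allFin k)

partWeight : {k r : ℕ} → (Fin r → ℕ) → Vec (Fin k) r → Fin k → ℕ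
partWeight {k} {r} n c a = sum (map (λ i → if ⌊ lookup c i ≟ a ⌋ then n i else 0) (allFin r))

pairSum : {k r : ℕ} → (Fin r → ℕ) → Vec (Fin k) r → ℕ
pairSum {k} n c =
  sum (map (λ a → sum (map (λ b → if toℕ a <ᵇ toℕ b then partWeight n c a * partWeight n c b else 0)
                           (allFin k)))
           (allFin k))

-- f(n_1,…,n_r,1,s) : maximum of pairSum over all partitions of [r] into s-1 parts.
f : {r : ℕ} → (Fin r → ℕ) → ℕ → ℕ
f {r} n s = foldr _⊔_ 0 (map (pairSum n) (filterᵇ isSurj (allMaps (s ∸ 1) r)))

-- Fix a partition of [r] into t − 2 parts. Two of the indices 1, …, t − 1, whose weights are
-- all at least n_{t−1}, lie in a common part I (pigeonhole). Moving one of them, y, into a new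
-- singleton part gives a partition into t − 1 parts whose pair sum is larger by
-- n_y (n_I − n_y) ≥ n_y n_x ≥ n_{t−1}².
module Submission where

open import Defs
open import Data.Nat using (ℕ; zero; suc; _+_; _*_; _∸_; _≤_; _<_; _⊔_; _⊓_; _<ᵇ_; s≤s; s≤s⁻¹; z≤n)
open import Data.Nat.Properties
  using ( +-*-semiring; +-identityʳ; +-assoc; +-comm; m≤m+n; m≤n+m; ≤-trans; ≤-reflexive; <⇒≤; n<1+n
        ; +-monoʳ-≤; *-monoʳ-≤; *-mono-≤; m≤m⊔n; m≤n⊔m; ⊔-lub; +-distribʳ-⊔; m⊓n≤n; m≤n⇒m⊓n≡m
        ; module ≤-Reasoning )
open import Data.Nat.Tactic.RingSolver using (solve-∀)
open import Data.Fin using (Fin; zero; suc; toℕ; inject≤; fromℕ<)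
import Data.Fin as F
open import Data.Fin.Properties
  using (_≟_; toℕ<n; toℕ≤pred[n]; toℕ-inject≤; inject≤-injective; fromℕ<-cong; fromℕ<-toℕ; <⇒≢; pigeonhole)
open import Data.Bool using (Bool; T; if_then_else_)
open import Data.Bool.ListAction using (any)
open import Data.List using ([]; _∷_; map; foldr; filterᵇ; allFin; tabulate)
import Data.Nat.ListAction as List
open import Data.List.Membership.Propositional using (_∈_)
open import Data.List.Membership.Propositional.Properties
  using (∈-map⁺; ∈-map⁻; ∈-concatMap⁺; ∈-filter⁺; ∈-filter⁻; ∈-allFin)
open import Data.List.Relation.Unary.Any using (here; there)
import Data.List.Relation.Unary.Any as Any
import Data.List.Relation.Unary.All as All
open import Data.List.Relation.Unary.All.Properties using (all⁺; all⁻)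
open import Data.List.Relation.Unary.Any.Properties using (any⁺; any⁻)
open import Data.Vec using (Vec; []; _∷_; lookup; toList; _[_]≔_)
import Data.Vec as Vec
open import Data.Vec.Properties using (lookup∘tabulate; lookup∘update; lookup∘update′; lookup-map)
import Data.Vec.Relation.Unary.Any as VecAny
open import Data.Vec.Relation.Unary.Any.Properties using (lookup-index; toList⁺; toList⁻)
open import Data.Vec.Membership.Propositional.Properties using (∈-lookup)
open import Data.Vec.Functional using (Vector; head; tail)
open import Algebra.Properties.Semiring.Sum +-*-semiring
  using (sum; sum-syntax; sum-cong-≗; ∑-distrib-+; *-distribˡ-sum; sum-replicate-zero)
open import Data.Product using (Σ; ∃-syntax; _,_)
open import Function using (id; _∘_)
open import Relation.Nullary using (yes; no; contradiction)
open import Relation.Nullary.Decidable using (⌊_⌋; toWitness; fromWitness; T?)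
open import Relation.Binary.PropositionalEquality
  using (_≡_; _≢_; _≗_; refl; sym; trans; cong; cong₂; subst; subst₂; module ≡-Reasoning)

δ : ∀ {k} → Fin k → Fin k → ℕ → ℕ
δ a b v = if ⌊ a ≟ b ⌋ then v else 0

δ-refl : ∀ {k} (a : Fin k) v → δ a a v ≡ v
δ-refl a v with a ≟ a
... | yes _ = refl
... | no a≢a = contradiction refl a≢a

δ-≢ : ∀ {k} {a b : Fin k} v → a ≢ b → δ a b v ≡ 0
δ-≢ {a = a} {b} v a≢b with a ≟ b
... | yes a≡b = contradiction a≡b a≢b
... | no _ = refl

-- Not definitional: ⌊_⌋ matches on the Dec record returned by map′.
δ-suc : ∀ {k} (a b : Fin k) v → δ (suc a) (suc b) v ≡ δ a b v
δ-suc a b v with a ≟ b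
... | yes _ = refl
... | no _ = refl

∑-δ : ∀ {k} (b : Fin k) v → ∑[ a < k ] δ b a v ≡ v
∑-δ {suc k} zero v = trans (cong (v +_) (sum-replicate-zero k)) (+-identityʳ v)
∑-δ {suc k} (suc b) v = trans (sum-cong-≗ (λ a → δ-suc b a v)) (∑-δ b v)

≤-∑ : ∀ {k} (u : Vector ℕ k) a → u a ≤ ∑[ b < k ] u b
≤-∑ u zero = m≤m+n _ _
≤-∑ u (suc a) = ≤-trans (≤-∑ (tail u) a) (m≤n+m _ _)

sum-map-tabulate : ∀ {A : Set} k (h : A → ℕ) (g : Fin k → A) →
  List.sum (map h (tabulate g)) ≡ ∑[ a < k ] h (g a)
sum-map-tabulate zero h g = refl
sum-map-tabulate (suc k) h g = cong (h (g zero) +_) (sum-map-tabulate k h (g ∘ suc))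

pairProducts : ∀ {k} → Vector ℕ k → ℕ
pairProducts {zero} w = 0
pairProducts {suc k} w = head w * sum (tail w) + pairProducts (tail w)

pairProducts-cong : ∀ {k} {v w : Vector ℕ k} → v ≗ w → pairProducts v ≡ pairProducts w
pairProducts-cong {zero} v≗w = refl
pairProducts-cong {suc k} v≗w =
  cong₂ _+_ (cong₂ _*_ (v≗w zero) (sum-cong-≗ (v≗w ∘ suc))) (pairProducts-cong (v≗w ∘ suc))

∑∑<≡pairProducts : ∀ {k} (w : Vector ℕ k) →
  ∑[ a < k ] ∑[ b < k ] (if toℕ a <ᵇ toℕ b then w a * w b else 0) ≡ pairProducts w
∑∑<≡pairProducts {zero} w = refl
∑∑<≡pairProducts {suc k} w =
  cong₂ _+_ (sym (*-distribˡ-sum (head w) (tail w))) (∑∑<≡pairProducts (tail w))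

-- The right-hand side is pairProducts of the vector d ∷ u, i.e. of w after the weight d is
-- taken out of part b and made into a part of its own.
pairProducts-+δ : ∀ {k} (w u : Vector ℕ k) (b : Fin k) (d : ℕ) → w ≗ (λ a → u a + δ b a d) →
  pairProducts w + d * u b ≡ pairProducts u + d * sum u
pairProducts-+δ {suc k} w u zero d w≗u+δ = begin
    head w * sum (tail w) + pairProducts (tail w) + d * u₀
  ≡⟨ cong₂ (λ x y → x * sum (tail w) + y + d * u₀) (w≗u+δ zero) (pairProducts-cong tail-w≗tail-u) ⟩
    (u₀ + d) * sum (tail w) + P + d * u₀
  ≡⟨ cong (λ s → (u₀ + d) * s + P + d * u₀) (sum-cong-≗ tail-w≗tail-u) ⟩
    (u₀ + d) * U + P + d * u₀
  ≡⟨ rearrange u₀ d U P ⟩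
    u₀ * U + P + d * (u₀ + U)
  ∎
  where
  open ≡-Reasoning
  u₀ = head u
  U = sum (tail u)
  P = pairProducts (tail u)
  tail-w≗tail-u : tail w ≗ tail u
  tail-w≗tail-u a = trans (w≗u+δ (suc a)) (+-identityʳ _)
  rearrange : ∀ x d s p → (x + d) * s + p + d * x ≡ x * s + p + d * (x + s)
  rearrange = solve-∀
pairProducts-+δ {suc k} w u (suc b) d w≗u+δ = begin
    head w * sum (tail w) + pairProducts (tail w) + d * u (suc b)
  ≡⟨ cong₂ (λ x s → x * s + pairProducts (tail w) + d * u (suc b))
           (trans (w≗u+δ zero) (+-identityʳ u₀)) sum-tail-w ⟩
    u₀ * (U + d) + pairProducts (tail w) + d * u (suc b)
  ≡⟨ +-assoc (u₀ * (U + d)) _ _ ⟩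
    u₀ * (U + d) + (pairProducts (tail w) + d * u (suc b))
  ≡⟨ cong (u₀ * (U + d) +_) (pairProducts-+δ (tail w) (tail u) b d tail-w≗tail-u+δ) ⟩
    u₀ * (U + d) + (P + d * U)
  ≡⟨ rearrange u₀ d U P ⟩
    u₀ * U + P + d * (u₀ + U)
  ∎
  where
  open ≡-Reasoning
  u₀ = head u
  U = sum (tail u)
  P = pairProducts (tail u)
  tail-w≗tail-u+δ : tail w ≗ (λ a → u (suc a) + δ b a d)
  tail-w≗tail-u+δ a = trans (w≗u+δ (suc a)) (cong (u (suc a) +_) (δ-suc b a d))
  sum-tail-w : sum (tail w) ≡ U + d
  sum-tail-w = trans (sum-cong-≗ tail-w≗tail-u+δ)
    (trans (∑-distrib-+ (tail u) (λ a → δ b a d)) (cong (U +_) (∑-δ b d)))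
  rearrange : ∀ x d s p → x * (s + d) + (p + d * s) ≡ x * s + p + d * (x + s)
  rearrange = solve-∀

partWeight≡∑ : ∀ {k r} (n : Fin r → ℕ) (c : Vec (Fin k) r) a →
  partWeight n c a ≡ ∑[ i < r ] δ (lookup c i) a (n i)
partWeight≡∑ {r = r} n c a = sum-map-tabulate r _ id

pairSum≡pairProducts : ∀ {k r} (n : Fin r → ℕ) (c : Vec (Fin k) r) →
  pairSum n c ≡ pairProducts (partWeight n c)
pairSum≡pairProducts {k} n c =
  trans (sum-map-tabulate k row id)
    (trans (sum-cong-≗ (λ a → sum-map-tabulate k (entry a) id)) (∑∑<≡pairProducts w))
  where
  w = partWeight n c
  entry : Fin k → Fin k → ℕ
  entry a b = if toℕ a <ᵇ toℕ b then w a * w b else 0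
  row : Fin k → ℕ
  row a = List.sum (map (entry a) (allFin k))

≤-partWeight : ∀ {k r} (n : Fin r → ℕ) (c : Vec (Fin k) r) i → n i ≤ partWeight n c (lookup c i)
≤-partWeight n c i =
  subst₂ _≤_ (δ-refl (lookup c i) (n i)) (sym (partWeight≡∑ n c (lookup c i)))
    (≤-∑ (λ j → δ (lookup c j) (lookup c i) (n j)) i)

Surjective : ∀ {k r} → Vec (Fin k) r → Set
Surjective {k} {r} c = ∀ (j : Fin k) → ∃[ i ] lookup c i ≡ j

equals : ∀ {k} → Fin k → Fin k → Bool
equals j x = ⌊ x ≟ j ⌋

isSurj⇒Surjective : ∀ {k r} (c : Vec (Fin k) r) → T (isSurj c) → Surjective c
isSurj⇒Surjective {k} c surj j =
  VecAny.index j∈c , toWitness {a? = lookup c (VecAny.index j∈c) ≟ j} (lookup-index j∈c)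
  where
  j∈c : VecAny.Any (T ∘ equals j) c
  j∈c = toList⁻ (any⁻ (equals j) _
    (All.lookup (all⁺ (λ j → any (equals j) (toList c)) (allFin k) surj) (∈-allFin j)))

Surjective⇒isSurj : ∀ {k r} (c : Vec (Fin k) r) → Surjective c → T (isSurj c)
Surjective⇒isSurj {k} c surj =
  all⁻ (λ j → any (equals j) (toList c)) {xs = allFin k} (All.universal j∈c _)
  where
  j∈c : ∀ j → T (any (equals j) (toList c))
  j∈c j with i , cᵢ≡j ← surj j =
    any⁺ (equals j)
      (toList⁺ (VecAny.map (λ cᵢ≡x → fromWitness (trans (sym cᵢ≡x) cᵢ≡j)) (∈-lookup i c)))

∈-allMaps : ∀ k r (c : Vec (Fin k) r) → c ∈ allMaps k r
∈-allMaps k zero [] = here refl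
∈-allMaps k (suc r) (x ∷ c) =
  ∈-concatMap⁺ (λ z → map (z ∷_) (allMaps k r))
    (Any.map (λ { refl → ∈-map⁺ (x ∷_) (∈-allMaps k r c) }) (∈-allFin x))

≤-foldr-⊔ : ∀ {y ys} → y ∈ ys → y ≤ foldr _⊔_ 0 ys
≤-foldr-⊔ {ys = z ∷ ys} (here refl) = m≤m⊔n z _
≤-foldr-⊔ {ys = z ∷ ys} (there y∈ys) = ≤-trans (≤-foldr-⊔ y∈ys) (m≤n⊔m z _)

foldr-⊔-+≤ : ∀ ys {d B} → (∀ {y} → y ∈ ys → y + d ≤ B) → d ≤ B → foldr _⊔_ 0 ys + d ≤ B
foldr-⊔-+≤ [] bound d≤B = d≤B
foldr-⊔-+≤ (z ∷ ys) {d} bound d≤B rewrite +-distribʳ-⊔ d z (foldr _⊔_ 0 ys) =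
  ⊔-lub (bound (here refl)) (foldr-⊔-+≤ ys (bound ∘ there) d≤B)

pairSum≤f : ∀ {k r} (n : Fin r → ℕ) (c : Vec (Fin k) r) → Surjective c → pairSum n c ≤ f n (suc k)
pairSum≤f {k} {r} n c surj =
  ≤-foldr-⊔ (∈-map⁺ (pairSum n)
    (∈-filter⁺ (T? ∘ isSurj) (∈-allMaps k r c) (Surjective⇒isSurj c surj)))

f+≤ : ∀ {k r} (n : Fin r → ℕ) {d B} → (∀ c → Surjective c → pairSum n c + d ≤ B) → d ≤ B →
  f n (suc k) + d ≤ B
f+≤ {k} {r} n {d} {B} bound = foldr-⊔-+≤ _ bound-on
  where
  bound-on : ∀ {y} → y ∈ map (pairSum n) (filterᵇ isSurj (allMaps k r)) → y + d ≤ B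
  bound-on y∈ with c , c∈ , refl ← ∈-map⁻ (pairSum n) y∈
    with _ , surj ← ∈-filter⁻ (T? ∘ isSurj) {xs = allMaps k r} c∈ =
      bound c (isSurj⇒Surjective c surj)

∃-surjection : ∀ {k r} → suc k ≤ r → Σ (Vec (Fin (suc k)) r) Surjective
∃-surjection {k} {r} k<r = Vec.tabulate clamp , λ j → inject≤ j k<r , clamp-inject≤ j
  where
  clamp : Fin r → Fin (suc k)
  clamp z = fromℕ< (s≤s (m⊓n≤n (toℕ z) k))
  clamp-inject≤ : ∀ j → lookup (Vec.tabulate clamp) (inject≤ j k<r) ≡ j
  clamp-inject≤ j = begin
    lookup (Vec.tabulate clamp) (inject≤ j k<r) ≡⟨ lookup∘tabulate clamp (inject≤ j k<r) ⟩
    clamp (inject≤ j k<r)                       ≡⟨ fromℕ<-cong _ (toℕ j) toℕj⊓k≡toℕj _ (toℕ<n j) ⟩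
    fromℕ< (toℕ<n j)                            ≡⟨ fromℕ<-toℕ j _ ⟩
    j                                           ∎
    where
    open ≡-Reasoning
    toℕj⊓k≡toℕj : toℕ (inject≤ j k<r) ⊓ k ≡ toℕ j
    toℕj⊓k≡toℕj = trans (cong (_⊓ k) (toℕ-inject≤ j k<r)) (m≤n⇒m⊓n≡m (toℕ≤pred[n] j))

isolate : ∀ {k r} → Vec (Fin k) r → Fin r → Vec (Fin (suc k)) r
isolate c y = Vec.map suc c [ y ]≔ zero

lookup-isolate : ∀ {k r} (c : Vec (Fin k) r) y → lookup (isolate c y) y ≡ zero
lookup-isolate c y = lookup∘update y (Vec.map suc c) zero

lookup-isolate-≢ : ∀ {k r} (c : Vec (Fin k) r) {y z} → z ≢ y →
  lookup (isolate c y) z ≡ suc (lookup c z)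
lookup-isolate-≢ c {z = z} z≢y =
  trans (lookup∘update′ z≢y (Vec.map suc c) zero) (lookup-map z suc c)

isolate-surjective : ∀ {k r} (c : Vec (Fin k) r) {x y} →
  Surjective c → x ≢ y → lookup c x ≡ lookup c y → Surjective (isolate c y)
isolate-surjective c {y = y} surj x≢y cx≡cy zero = y , lookup-isolate c y
isolate-surjective c {x} {y} surj x≢y cx≡cy (suc j) with z , cz≡j ← surj j | z ≟ y
... | no z≢y = z , trans (lookup-isolate-≢ c z≢y) (cong suc cz≡j)
... | yes refl = x , trans (lookup-isolate-≢ c x≢y) (cong suc (trans cx≡cy cz≡j))

partWeight-isolate-zero : ∀ {k r} (n : Fin r → ℕ) (c : Vec (Fin k) r) y →
  partWeight n (isolate c y) zero ≡ n y
partWeight-isolate-zero n c y =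
  trans (partWeight≡∑ n (isolate c y) zero) (trans (sum-cong-≗ only-y) (∑-δ y (n y)))
  where
  only-y : ∀ i → δ (lookup (isolate c y) i) zero (n i) ≡ δ y i (n y)
  only-y i with i ≟ y
  ... | yes refl rewrite lookup-isolate c i = sym (δ-refl i (n i))
  ... | no i≢y rewrite lookup-isolate-≢ c i≢y = sym (δ-≢ (n y) (i≢y ∘ sym))

partWeight-isolate-suc : ∀ {k r} (n : Fin r → ℕ) (c : Vec (Fin k) r) y a →
  partWeight n c a ≡ partWeight n (isolate c y) (suc a) + δ (lookup c y) a (n y)
partWeight-isolate-suc {r = r} n c y a = begin
  partWeight n c a                                          ≡⟨ partWeight≡∑ n c a ⟩
  ∑[ i < r ] δ (lookup c i) a (n i)                          ≡⟨ sum-cong-≗ split ⟩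
  ∑[ i < r ] (δ (lookup c' i) (suc a) (n i) + δ y i moved)
    ≡⟨ ∑-distrib-+ (λ i → δ (lookup c' i) (suc a) (n i)) (λ i → δ y i moved) ⟩
  ∑[ i < r ] δ (lookup c' i) (suc a) (n i) + ∑[ i < r ] δ y i moved
    ≡⟨ cong₂ _+_ (sym (partWeight≡∑ n c' (suc a))) (∑-δ y moved) ⟩
  partWeight n c' (suc a) + moved                           ∎
  where
  open ≡-Reasoning
  c' = isolate c y
  moved = δ (lookup c y) a (n y)
  split : ∀ i → δ (lookup c i) a (n i) ≡ δ (lookup c' i) (suc a) (n i) + δ y i moved
  split i with i ≟ y
  ... | yes refl rewrite lookup-isolate c i = sym (δ-refl i moved)
  ... | no i≢y rewrite lookup-isolate-≢ c i≢y | δ-≢ moved (i≢y ∘ sym) =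
    sym (trans (+-identityʳ _) (δ-suc (lookup c i) a (n i)))

pairSum-isolate : ∀ {k r} (n : Fin r → ℕ) (c : Vec (Fin k) r) y →
  pairSum n c + n y * partWeight n (isolate c y) (suc (lookup c y)) ≡ pairSum n (isolate c y)
pairSum-isolate n c y = begin
  pairSum n c + n y * u (lookup c y)
    ≡⟨ cong (_+ n y * u (lookup c y)) (pairSum≡pairProducts n c) ⟩
  pairProducts (partWeight n c) + n y * u (lookup c y)
    ≡⟨ pairProducts-+δ (partWeight n c) u (lookup c y) (n y) (partWeight-isolate-suc n c y) ⟩
  pairProducts u + n y * sum u
    ≡⟨ +-comm (pairProducts u) (n y * sum u) ⟩
  n y * sum u + pairProducts u
    ≡⟨ cong (λ x → x * sum u + pairProducts u) (sym (partWeight-isolate-zero n c y)) ⟩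
  pairProducts (partWeight n (isolate c y))
    ≡⟨ sym (pairSum≡pairProducts n (isolate c y)) ⟩
  pairSum n (isolate c y) ∎
  where
  open ≡-Reasoning
  u = tail (partWeight n (isolate c y))

pairSum-isolate-≥ : ∀ {k r} (n : Fin r → ℕ) (c : Vec (Fin k) r) {x y} →
  x ≢ y → lookup c x ≡ lookup c y → pairSum n c + n y * n x ≤ pairSum n (isolate c y)
pairSum-isolate-≥ n c {x} {y} x≢y cx≡cy =
  subst (pairSum n c + n y * n x ≤_) (pairSum-isolate n c y)
    (+-monoʳ-≤ (pairSum n c) (*-monoʳ-≤ (n y) n-x≤))
  where
  n-x≤ : n x ≤ partWeight n (isolate c y) (suc (lookup c y))
  n-x≤ = subst (λ a → n x ≤ partWeight n (isolate c y) a)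
    (trans (lookup-isolate-≢ c x≢y) (cong suc cx≡cy)) (≤-partWeight n (isolate c y) x)

pairSum+square≤f : ∀ {m r} (n : Fin r → ℕ) {a} → m < r → (∀ x → toℕ x ≤ m → a ≤ n x) →
  (c : Vec (Fin m) r) → Surjective c → pairSum n c + a * a ≤ f n (suc (suc m))
pairSum+square≤f {m} n {a} m<r large c surj
  with p , q , p<q , cx≡cy ← pigeonhole (n<1+n m) (lookup c ∘ λ p → inject≤ p m<r) = begin
    pairSum n c + a * a       ≤⟨ +-monoʳ-≤ (pairSum n c) (*-mono-≤ (large-on q) (large-on p)) ⟩
    pairSum n c + n y * n x   ≤⟨ pairSum-isolate-≥ n c x≢y cx≡cy ⟩
    pairSum n (isolate c y)   ≤⟨ pairSum≤f n (isolate c y) (isolate-surjective c surj x≢y cx≡cy) ⟩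
    f n (suc (suc m))         ∎
  where
  open ≤-Reasoning
  x = inject≤ p m<r
  y = inject≤ q m<r
  x≢y : x ≢ y
  x≢y = <⇒≢ p<q ∘ inject≤-injective m<r m<r p q
  large-on : ∀ p → a ≤ n (inject≤ p m<r)
  large-on p = large (inject≤ p m<r) (≤-trans (≤-reflexive (toℕ-inject≤ p m<r)) (toℕ≤pred[n] p))

-- f is a fold with default 0, so the bound a * a ≤ f n (suc (suc m)) for that default
-- has to come from some partition c₀ into m parts.
f+square≤f : ∀ {m r} (n : Fin r → ℕ) {a} → 1 ≤ m → m < r → (∀ x → toℕ x ≤ m → a ≤ n x) →
  f n (suc m) + a * a ≤ f n (suc (suc m))
f+square≤f {suc m} n (s≤s z≤n) m<r large with c₀ , surj₀ ← ∃-surjection (<⇒≤ m<r) =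
  f+≤ n (pairSum+square≤f n m<r large)
    (≤-trans (m≤n+m _ (pairSum n c₀)) (pairSum+square≤f n m<r large c₀ surj₀))

proposition3p1 : (r t : ℕ) → 3 ≤ t → t ≤ r →
    (n : Fin r → ℕ) →
    (∀ (i j : Fin r) → i F.≤ j → n j ≤ n i) →
    (∀ (i : Fin r) → 1 ≤ n i) →
    (i : Fin r) → toℕ i + 2 ≡ t →
    f n (t ∸ 1) + n i * n i ≤ f n t
proposition3p1 r .(toℕ i + 2) 3≤t _ n antitone _ i refl rewrite +-comm (toℕ i) 2 =
  f+square≤f n (s≤s⁻¹ (s≤s⁻¹ 3≤t)) (toℕ<n i) (λ x x≤i → antitone x i x≤i)
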